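{- Let $q \ge 3$, let $m \in A = \mathbb{F}_q[T]$ be a monic polynomial of degree $d \ge 1$, and let $\alpha \in A$ be a polynomial of degree $h \ge 0$ (in particular $\alpha \neq 0$). Assume that $C_m(\alpha)$ is a monic prime in $A$. Then $m$ is a monic prime in $A$ and $\alpha \in \mathbb{F}_q^{\times}$.
   Context: $q$ is a power of a prime $p$, $\mathbb{F}_q$ is the finite field with $q$ elements, $A = \mathbb{F}_q[T]$ and $k = \mathbb{F}_q(T)$. The Carlitz module is the unique $\mathbb{F}_q$-algebra homomorphism $a \mapsto C_a$ from $A$ to the ring of $\mathbb{F}_q$-linear polynomials (composition as multiplication) with $C_T(x) = Tx + x^q$; thus for every $a \in A$, $C_a(x) \in A[x]$ is a polynomial, and for $\beta$ in a commutative $k$-algebra (e.g. $\beta \in A$) one evaluates $C_a(\beta)$. "Prime" in $A$ means irreducible polynomial of positive degree. -}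

module Defs where

open import Level using (Level; _⊔_) renaming (suc to lsuc)
open import Data.Nat using (ℕ; zero; suc; _<_; _≤_)
open import Data.Fin using (Fin)
open import Data.List using (List; []; _∷_; map)
open import Data.Product using (Σ; ∃; _×_; _,_)
open import Data.Sum using (_⊎_)
open import Function.Bundles using (_↔_)
open import Relation.Binary.PropositionalEquality using (_≡_; _≢_)
open import Algebra.Structures using (IsCommutativeRing)

record FiniteField (q : ℕ) : Set₁ where
  field
    Carrier : Set
    _+_ _*_ : Carrier → Carrier → Carrier
    -_      : Carrier → Carrier
    0# 1#   : Carrier
    isCommutativeRing : IsCommutativeRing _≡_ _+_ _*_ -_ 0# 1#
    0≢1     : 0# ≢ 1#
    inverse : (x : Carrier) → x ≢ 0# → Σ Carrier (λ y → x * y ≡ 1#)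
    card    : Carrier ↔ Fin q

-- Polynomials in A = F_q[T], as coefficient lists (constant term first);
-- equality is coefficientwise (trailing zeros irrelevant).
module Poly {q : ℕ} (F : FiniteField q) where
  open FiniteField F

  Pol : Set
  Pol = List Carrier

  coeff : Pol → ℕ → Carrier
  coeff []       _       = 0#
  coeff (a ∷ p)  zero    = a
  coeff (a ∷ p)  (suc i) = coeff p i

  _≈P_ : Pol → Pol → Set
  p ≈P r = (i : ℕ) → coeff p i ≡ coeff r i

  _+P_ : Pol → Pol → Pol
  []      +P r       = r
  (a ∷ p) +P []      = a ∷ p
  (a ∷ p) +P (b ∷ r) = (a + b) ∷ (p +P r)

  scale : Carrier → Pol → Pol
  scale c p = map (c *_) p

  shiftT : Pol → Pol
  shiftT p = 0# ∷ p

  _*P_ : Pol → Pol → Pol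
  []      *P r = []
  (a ∷ p) *P r = scale a r +P shiftT (p *P r)

  oneP : Pol
  oneP = 1# ∷ []

  powP : Pol → ℕ → Pol
  powP p zero    = oneP
  powP p (suc n) = p *P powP p n

  carlitzT : Pol → Pol
  carlitzT β = shiftT β +P powP β q

  -- C_m(β) = Σ_i m_i C_T^i(β)  for m = Σ_i m_i T^i
  carlitz : Pol → Pol → Pol
  carlitz []      β = []
  carlitz (a ∷ m) β = scale a β +P carlitz m (carlitzT β)

  HasDegree : Pol → ℕ → Set
  HasDegree p d = (coeff p d ≢ 0#) × ((i : ℕ) → d < i → coeff p i ≡ 0#)

  Monic : Pol → Set
  Monic p = Σ ℕ λ d → HasDegree p d × (coeff p d ≡ 1#)

  IsUnit : Pol → Set
  IsUnit p = Σ Pol λ u → (p *P u) ≈P oneP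

  Prime : Pol → Set
  Prime p = (Σ ℕ λ d → HasDegree p d × (1 ≤ d))
          × ((a b : Pol) → p ≈P (a *P b) → IsUnit a ⊎ IsUnit b)

  NonzeroConstant : Pol → Set
  NonzeroConstant α = Σ Carrier λ c → (c ≢ 0#) × (α ≈P (c ∷ []))

module Submission where

-- For every a, C_a(x) is divisible by x, and if deg a ≥ 1 and β ≠ 0 then
-- deg C_a(β) > deg β (here q ≥ 3 is used). So α is a factor of C_m(α) of smaller degree,
-- and irreducibility forces α to be a unit, i.e. a nonzero constant. If m = ab with
-- deg a, deg b ≥ 1, then C_m(α) = C_a(C_b(α)) has the factor C_b(α) of intermediate
-- degree, so m is irreducible. The composition rule C_{ab} = C_a ∘ C_b rests on the
-- F_q-linearity of C_T, i.e. on c^q = c in F_q and (β + γ)^q = β^q + γ^q in F_q[T];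
-- the latter holds because the binomial coefficients (q choose k), 0 < k < q, vanish
-- in F_q: Σ_{k<q} (q choose k) x^k − 1 has degree < q and, as (x + 1)^q = x + 1,
-- it vanishes at all q elements of F_q.

open import Defs
open import Data.Nat using (ℕ; _≤_)
open import Data.Product using (Σ; _×_)
open import Level using (0ℓ)
open import Data.Nat as ℕ using (zero; suc; _<_; _∸_; z≤n; s≤s)
import Data.Nat.Properties as ℕ
open import Data.Nat.Combinatorics using (_C_; nCn≡1)
open import Data.Fin as Fin using (Fin; toℕ; fromℕ; inject₁)
import Data.Fin.Properties as Fin
open import Data.Fin.Permutation using (Permutation)
open import Data.List using ([]; _∷_; map)
open import Data.Product using (_,_; proj₁; proj₂)
open import Data.Sum using (_⊎_; inj₁; inj₂)
open import Data.Empty using (⊥; ⊥-elim)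
open import Relation.Nullary using (Dec; yes; no; ¬_)
open import Relation.Binary.Bundles using (Setoid)
open import Relation.Binary.Structures using (IsEquivalence)
open import Relation.Binary.Definitions using (tri<; tri≈; tri>)
open import Relation.Binary.PropositionalEquality as ≡ using (_≡_; _≢_; refl; cong; cong₂)
import Relation.Binary.Reasoning.Setoid as SetoidReasoning
open import Function.Base using (_∘_)
open import Function.Bundles using (Inverse; Injection; mk↔ₛ′)
open import Function.Definitions using (Injective)
open import Function.Properties.Inverse using (↔⇒↣)
open import Function.Construct.Composition using (_↔-∘_)
open import Function.Construct.Symmetry using (↔-sym)
open import Algebra.Bundles using (CommutativeRing; AbelianGroup)
open import Algebra.Structures using (IsAbelianGroup)
import Algebra.Properties.Group as GroupProperties
import Algebra.Properties.CommutativeSemigroup as CommutativeSemigroupProperties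
import Algebra.Properties.CommutativeMonoid.Sum as MonoidSum
import Algebra.Properties.Semiring.Sum as SemiringSum
import Algebra.Properties.Semiring.Mult as SemiringMult
import Algebra.Properties.Semiring.Exp as SemiringExp
import Algebra.Properties.CommutativeSemiring.Binomial as CommutativeSemiringBinomial

module FieldProperties {q : ℕ} (F : FiniteField q) where
  open FiniteField F public using (0≢1)
  open FiniteField F using (inverse; card)

  fieldRing : CommutativeRing 0ℓ 0ℓ
  fieldRing = record { isCommutativeRing = FiniteField.isCommutativeRing F }

  open CommutativeRing fieldRing public
    hiding (refl; sym; trans; reflexive; isEquivalence; setoid; zero)
  open import Algebra.Properties.CommutativeSemiring.Exp commutativeSemiring public
    using (_^_)
  open CommutativeSemigroupProperties *-commutativeSemigroup public
    using (x∙yz≈y∙xz)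
  open CommutativeSemigroupProperties +-commutativeSemigroup public
    using () renaming (interchange to +-interchange)
  open ≡.≡-Reasoning

  infix 4 _≟_
  _≟_ : (x y : Carrier) → Dec (x ≡ y)
  _≟_ = Fin.inj⇒≟ (↔⇒↣ card)

  1≢0 : 1# ≢ 0#
  1≢0 e = 0≢1 (≡.sym e)

  inv : (x : Carrier) → x ≢ 0# → Carrier
  inv x x≢0 = proj₁ (inverse x x≢0)

  *-inverseʳ : ∀ x (x≢0 : x ≢ 0#) → x * inv x x≢0 ≡ 1#
  *-inverseʳ x x≢0 = proj₂ (inverse x x≢0)

  *-cancelʳ : ∀ {a b c} → c ≢ 0# → a * c ≡ b * c → a ≡ b
  *-cancelʳ {a} {b} {c} c≢0 ac≡bc = begin
    a                   ≡⟨ *-identityʳ a ⟨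
    a * 1#              ≡⟨ cong (a *_) (*-inverseʳ c c≢0) ⟨
    a * (c * inv c c≢0) ≡⟨ *-assoc a c _ ⟨
    a * c * inv c c≢0   ≡⟨ cong (_* inv c c≢0) ac≡bc ⟩
    b * c * inv c c≢0   ≡⟨ *-assoc b c _ ⟩
    b * (c * inv c c≢0) ≡⟨ cong (b *_) (*-inverseʳ c c≢0) ⟩
    b * 1#              ≡⟨ *-identityʳ b ⟩
    b                   ∎

  *-nonzero : ∀ {x y} → x ≢ 0# → y ≢ 0# → x * y ≢ 0#
  *-nonzero {x} {y} x≢0 y≢0 xy≡0 = x≢0 (*-cancelʳ y≢0 (≡.trans xy≡0 (≡.sym (zeroˡ y))))

  open MonoidSum *-commutativeMonoid using ()
    renaming (sum to ∏; sum-cong-≗ to ∏-cong; sum-permute to ∏-permute; sum-remove to ∏-remove;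
              ∑-distrib-+ to ∏-distrib-*; sum-replicate to ∏-replicate; sum-replicate-zero to ∏-replicate-one)

  ∏-scale : ∀ {n} c (f : Fin n → Carrier) → ∏ (λ i → c * f i) ≡ c ^ n * ∏ f
  ∏-scale {n} c f = ≡.trans (∏-distrib-* (λ _ → c) f) (cong (_* ∏ f) (∏-replicate n))

  ∏-single : ∀ {n} (f : Fin n → Carrier) i₀ → (∀ j → j ≢ i₀ → f j ≡ 1#) → ∏ f ≡ f i₀
  ∏-single {suc n} f i₀ f≡1 = begin
    ∏ f                                  ≡⟨ ∏-remove {i = i₀} f ⟩
    f i₀ * ∏ (λ j → f (Fin.punchIn i₀ j)) ≡⟨ cong (f i₀ *_) ∏-ones ⟩
    f i₀ * 1#                            ≡⟨ *-identityʳ (f i₀) ⟩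
    f i₀                                 ∎
    where
    ∏-ones : ∏ (λ j → f (Fin.punchIn i₀ j)) ≡ 1#
    ∏-ones = ≡.trans (∏-cong (λ j → f≡1 _ (Fin.punchInᵢ≢i i₀ j))) (∏-replicate-one n)

  ∏-nonzero : ∀ {n} (f : Fin n → Carrier) → (∀ i → f i ≢ 0#) → ∏ f ≢ 0#
  ∏-nonzero {zero}  f f≢0 = 1≢0
  ∏-nonzero {suc n} f f≢0 = *-nonzero (f≢0 Fin.zero) (∏-nonzero (f ∘ Fin.suc) (f≢0 ∘ Fin.suc))

  ^-zeroˡ : ∀ n → .{{ℕ.NonZero n}} → 0# ^ n ≡ 0#
  ^-zeroˡ (suc n) = zeroˡ _

  orOne : Carrier → Carrier
  orOne y with y ≟ 0#
  ... | yes _ = 1#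
  ... | no  _ = y

  orOne-nonzero : ∀ y → orOne y ≢ 0#
  orOne-nonzero y with y ≟ 0#
  ... | yes _   = 1≢0
  ... | no  y≢0 = y≢0

  ifZero : Carrier → Carrier → Carrier
  ifZero x y with y ≟ 0#
  ... | yes _ = x
  ... | no  _ = 1#

  ifZero-≢0 : ∀ x {y} → y ≢ 0# → ifZero x y ≡ 1#
  ifZero-≢0 x {y} y≢0 with y ≟ 0#
  ... | yes y≡0 = ⊥-elim (y≢0 y≡0)
  ... | no  _   = refl

  ifZero-0 : ∀ x → ifZero x 0# ≡ x
  ifZero-0 x with 0# ≟ 0#
  ... | yes _   = refl
  ... | no  0≢0 = ⊥-elim (0≢0 refl)

  *-orOne : ∀ {x} → x ≢ 0# → ∀ y → x * orOne y ≡ orOne (x * y) * ifZero x y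
  *-orOne {x} x≢0 y with y ≟ 0# | x * y ≟ 0#
  ... | yes _   | yes _    = ≡.trans (*-identityʳ x) (≡.sym (*-identityˡ x))
  ... | yes y≡0 | no xy≢0  = ⊥-elim (xy≢0 (≡.trans (cong (x *_) y≡0) (zeroʳ x)))
  ... | no y≢0  | yes xy≡0 = ⊥-elim (*-nonzero x≢0 y≢0 xy≡0)
  ... | no _    | no _     = ≡.sym (*-identityʳ (x * y))

  enumerate : Fin q → Carrier
  enumerate = Inverse.from card

  enumerate-injective : Injective _≡_ _≡_ enumerate
  enumerate-injective = Injection.injective (↔⇒↣ (↔-sym card))

  private
    index : Carrier → Fin q
    index = Inverse.to card

    enumerate-index : ∀ y → enumerate (index y) ≡ y
    enumerate-index = Inverse.strictlyInverseʳ card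

  q-nonZero : ℕ.NonZero q
  q-nonZero = Fin.nonZeroIndex (index 0#)

  scalingPermutation : ∀ {x} → x ≢ 0# → Permutation q q
  scalingPermutation {x} x≢0 = card ↔-∘ (mk↔ₛ′ (x *_) (inv x x≢0 *_) x*x⁻¹* x⁻¹*x* ↔-∘ ↔-sym card)
    where
    x*x⁻¹* : ∀ y → x * (inv x x≢0 * y) ≡ y
    x*x⁻¹* y = ≡.trans (≡.sym (*-assoc x _ y)) (≡.trans (cong (_* y) (*-inverseʳ x x≢0)) (*-identityˡ y))
    x⁻¹*x* : ∀ y → inv x x≢0 * (x * y) ≡ y
    x⁻¹*x* y = ≡.trans (x∙yz≈y∙xz (inv x x≢0) x y) (x*x⁻¹* y)

  -- Multiplication by x permutes F, so the product P of the elements of F with 0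
  -- replaced by 1 satisfies x^q P = x P: each factor gains an x, except the one at 0.
  fermat-nonzero : ∀ {x} → x ≢ 0# → x ^ q ≡ x
  fermat-nonzero {x} x≢0 = *-cancelʳ (∏-nonzero (orOne ∘ enumerate) (orOne-nonzero ∘ enumerate)) (begin
    x ^ q * P                                                      ≡⟨ ∏-scale x (orOne ∘ enumerate) ⟨
    ∏ (λ i → x * orOne (enumerate i))                              ≡⟨ ∏-cong (*-orOne x≢0 ∘ enumerate) ⟩
    ∏ (λ i → orOne (x * enumerate i) * ifZero x (enumerate i))     ≡⟨ ∏-distrib-* (orOne ∘ (x *_) ∘ enumerate) _ ⟩
    ∏ (λ i → orOne (x * enumerate i)) * ∏ (ifZero x ∘ enumerate)   ≡⟨ cong₂ _*_ permuted corrections ⟩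
    P * x                                                          ≡⟨ *-comm P x ⟩
    x * P                                                          ∎)
    where
    P : Carrier
    P = ∏ (orOne ∘ enumerate)
    permuted : ∏ (λ i → orOne (x * enumerate i)) ≡ P
    permuted = ≡.sym (≡.trans (∏-permute (orOne ∘ enumerate) (scalingPermutation x≢0))
                              (∏-cong (λ i → cong orOne (enumerate-index (x * enumerate i)))))
    corrections : ∏ (ifZero x ∘ enumerate) ≡ x
    corrections = begin
      ∏ (ifZero x ∘ enumerate)        ≡⟨ ∏-single _ (index 0#) (λ j j≢0 → ifZero-≢0 x (j≢0 ∘ enumerate≡0)) ⟩
      ifZero x (enumerate (index 0#)) ≡⟨ cong (ifZero x) (enumerate-index 0#) ⟩
      ifZero x 0#                     ≡⟨ ifZero-0 x ⟩
      x                               ∎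
      where
      enumerate≡0 : ∀ {j} → enumerate j ≡ 0# → j ≡ index 0#
      enumerate≡0 e = enumerate-injective (≡.trans e (≡.sym (enumerate-index 0#)))

  fermat : ∀ x → x ^ q ≡ x
  fermat x with x ≟ 0#
  ... | no  x≢0 = fermat-nonzero x≢0
  ... | yes refl = ^-zeroˡ q {{q-nonZero}}

module PolynomialRing {q : ℕ} (F : FiniteField q) where
  open FieldProperties F
  open Poly F public

  -- _≈P_ unfolds to a Π-type, from which Agda cannot recover the two polynomials;
  -- wrapping it in a record makes them inferable.
  infix 4 _≋_
  record _≋_ (p r : Pol) : Set where
    constructor coeffwise
    field coeff-≡ : p ≈P r
  open _≋_ public

  ≋-isEquivalence : IsEquivalence _≋_
  ≋-isEquivalence = record
    { refl  = coeffwise λ _ → refl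
    ; sym   = λ p≋r → coeffwise λ i → ≡.sym (coeff-≡ p≋r i)
    ; trans = λ p≋r r≋s → coeffwise λ i → ≡.trans (coeff-≡ p≋r i) (coeff-≡ r≋s i)
    }

  ≋-setoid : Setoid 0ℓ 0ℓ
  ≋-setoid = record { isEquivalence = ≋-isEquivalence }

  open IsEquivalence ≋-isEquivalence public using ()
    renaming (refl to ≋-refl; sym to ≋-sym; trans to ≋-trans; reflexive to ≋-reflexive)
  module ≋-Reasoning = SetoidReasoning ≋-setoid

  negP : Pol → Pol
  negP = map (-_)

  coeff-+P : ∀ p r i → coeff (p +P r) i ≡ coeff p i + coeff r i
  coeff-+P []      r       i       = ≡.sym (+-identityˡ _)
  coeff-+P (a ∷ p) []      i       = ≡.sym (+-identityʳ _)
  coeff-+P (a ∷ p) (b ∷ r) zero    = refl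
  coeff-+P (a ∷ p) (b ∷ r) (suc i) = coeff-+P p r i

  coeff-scale : ∀ c p i → coeff (scale c p) i ≡ c * coeff p i
  coeff-scale c []      i       = ≡.sym (zeroʳ c)
  coeff-scale c (a ∷ p) zero    = refl
  coeff-scale c (a ∷ p) (suc i) = coeff-scale c p i

  coeff-negP : ∀ p i → coeff (negP p) i ≡ - coeff p i
  coeff-negP []      i       = ≡.sym (GroupProperties.ε⁻¹≈ε +-group)
  coeff-negP (a ∷ p) zero    = refl
  coeff-negP (a ∷ p) (suc i) = coeff-negP p i

  ∷-cong : ∀ {a b p r} → a ≡ b → p ≋ r → a ∷ p ≋ b ∷ r
  ∷-cong a≡b p≋r = coeffwise λ { zero → a≡b ; (suc i) → coeff-≡ p≋r i }

  ∷-injectiveʳ : ∀ {a b p r} → a ∷ p ≋ b ∷ r → p ≋ r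
  ∷-injectiveʳ e = coeffwise (coeff-≡ e ∘ suc)

  ∷-zeroʳ : ∀ {a p} → a ∷ p ≋ [] → p ≋ []
  ∷-zeroʳ e = coeffwise (coeff-≡ e ∘ suc)

  +P-cong : ∀ {p p′ r r′} → p ≋ p′ → r ≋ r′ → p +P r ≋ p′ +P r′
  +P-cong {p} {p′} {r} {r′} p≋p′ r≋r′ = coeffwise λ i → begin
    coeff (p +P r) i          ≡⟨ coeff-+P p r i ⟩
    coeff p i + coeff r i     ≡⟨ cong₂ _+_ (coeff-≡ p≋p′ i) (coeff-≡ r≋r′ i) ⟩
    coeff p′ i + coeff r′ i   ≡⟨ coeff-+P p′ r′ i ⟨
    coeff (p′ +P r′) i        ∎
    where open ≡.≡-Reasoning

  scale-cong : ∀ c {p r} → p ≋ r → scale c p ≋ scale c r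
  scale-cong c {p} {r} p≋r = coeffwise λ i →
    ≡.trans (coeff-scale c p i) (≡.trans (cong (c *_) (coeff-≡ p≋r i)) (≡.sym (coeff-scale c r i)))

  negP-cong : ∀ {p r} → p ≋ r → negP p ≋ negP r
  negP-cong {p} {r} p≋r = coeffwise λ i →
    ≡.trans (coeff-negP p i) (≡.trans (cong -_ (coeff-≡ p≋r i)) (≡.sym (coeff-negP r i)))

  shiftT-cong : ∀ {p r} → p ≋ r → shiftT p ≋ shiftT r
  shiftT-cong = ∷-cong refl

  +P-comm : ∀ p r → p +P r ≋ r +P p
  +P-comm p r = coeffwise λ i →
    ≡.trans (coeff-+P p r i) (≡.trans (+-comm _ _) (≡.sym (coeff-+P r p i)))

  +P-assoc : ∀ p r s → (p +P r) +P s ≋ p +P (r +P s)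
  +P-assoc p r s = coeffwise λ i → begin
    coeff ((p +P r) +P s) i                ≡⟨ coeff-+P (p +P r) s i ⟩
    coeff (p +P r) i + coeff s i           ≡⟨ cong (_+ coeff s i) (coeff-+P p r i) ⟩
    coeff p i + coeff r i + coeff s i      ≡⟨ +-assoc _ _ _ ⟩
    coeff p i + (coeff r i + coeff s i)    ≡⟨ cong (coeff p i +_) (coeff-+P r s i) ⟨
    coeff p i + coeff (r +P s) i           ≡⟨ coeff-+P p (r +P s) i ⟨
    coeff (p +P (r +P s)) i                ∎
    where open ≡.≡-Reasoning

  +P-identityʳ : ∀ p → p +P [] ≋ p
  +P-identityʳ p = coeffwise λ i → ≡.trans (coeff-+P p [] i) (+-identityʳ _)

  +P-inverseˡ : ∀ p → negP p +P p ≋ []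
  +P-inverseˡ p = coeffwise λ i →
    ≡.trans (coeff-+P (negP p) p i) (≡.trans (cong (_+ coeff p i) (coeff-negP p i)) (-‿inverseˡ _))

  +P-isAbelianGroup : IsAbelianGroup _≋_ _+P_ [] negP
  +P-isAbelianGroup = record
    { isGroup = record
      { isMonoid = record
        { isSemigroup = record
          { isMagma = record { isEquivalence = ≋-isEquivalence ; ∙-cong = +P-cong }
          ; assoc   = +P-assoc
          }
        ; identity = (λ _ → ≋-refl) , +P-identityʳ
        }
      ; inverse = +P-inverseˡ , λ p → ≋-trans (+P-comm p (negP p)) (+P-inverseˡ p)
      ; ⁻¹-cong = negP-cong
      }
    ; comm = +P-comm
    }

  +P-abelianGroup : AbelianGroup 0ℓ 0ℓ
  +P-abelianGroup = record { isAbelianGroup = +P-isAbelianGroup }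

  open CommutativeSemigroupProperties (AbelianGroup.commutativeSemigroup +P-abelianGroup) public
    using () renaming (interchange to +P-interchange)

  scale-+P : ∀ c p r → scale c (p +P r) ≋ scale c p +P scale c r
  scale-+P c p r = coeffwise λ i → begin
    coeff (scale c (p +P r)) i                  ≡⟨ coeff-scale c (p +P r) i ⟩
    c * coeff (p +P r) i                        ≡⟨ cong (c *_) (coeff-+P p r i) ⟩
    c * (coeff p i + coeff r i)                 ≡⟨ distribˡ c _ _ ⟩
    c * coeff p i + c * coeff r i               ≡⟨ cong₂ _+_ (coeff-scale c p i) (coeff-scale c r i) ⟨
    coeff (scale c p) i + coeff (scale c r) i   ≡⟨ coeff-+P (scale c p) (scale c r) i ⟨
    coeff (scale c p +P scale c r) i            ∎
    where open ≡.≡-Reasoning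

  scale-distribʳ : ∀ c d p → scale (c + d) p ≋ scale c p +P scale d p
  scale-distribʳ c d p = coeffwise λ i → begin
    coeff (scale (c + d) p) i                   ≡⟨ coeff-scale (c + d) p i ⟩
    (c + d) * coeff p i                         ≡⟨ distribʳ (coeff p i) c d ⟩
    c * coeff p i + d * coeff p i               ≡⟨ cong₂ _+_ (coeff-scale c p i) (coeff-scale d p i) ⟨
    coeff (scale c p) i + coeff (scale d p) i   ≡⟨ coeff-+P (scale c p) (scale d p) i ⟨
    coeff (scale c p +P scale d p) i            ∎
    where open ≡.≡-Reasoning

  scale-scale : ∀ c d p → scale c (scale d p) ≋ scale (c * d) p
  scale-scale c d p = coeffwise λ i → begin
    coeff (scale c (scale d p)) i ≡⟨ coeff-scale c (scale d p) i ⟩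
    c * coeff (scale d p) i       ≡⟨ cong (c *_) (coeff-scale d p i) ⟩
    c * (d * coeff p i)           ≡⟨ *-assoc c d _ ⟨
    c * d * coeff p i             ≡⟨ coeff-scale (c * d) p i ⟨
    coeff (scale (c * d) p) i     ∎
    where open ≡.≡-Reasoning

  scale-one : ∀ p → scale 1# p ≋ p
  scale-one p = coeffwise λ i → ≡.trans (coeff-scale 1# p i) (*-identityˡ _)

  scale-zero : ∀ p → scale 0# p ≋ []
  scale-zero p = coeffwise λ i → ≡.trans (coeff-scale 0# p i) (zeroˡ _)

  scale-≡ : ∀ {c d} p → c ≡ d → scale c p ≋ scale d p
  scale-≡ p refl = ≋-refl

  scale-shiftT : ∀ c p → scale c (shiftT p) ≋ shiftT (scale c p)
  scale-shiftT c p = ∷-cong (zeroʳ c) ≋-refl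

  shiftT-+P : ∀ p r → shiftT (p +P r) ≋ shiftT p +P shiftT r
  shiftT-+P p r = ∷-cong (≡.sym (+-identityʳ 0#)) ≋-refl

  shiftT-[] : shiftT [] ≋ []
  shiftT-[] = coeffwise λ { zero → refl ; (suc i) → refl }

  *P-zeroˡ : ∀ {p} r → p ≋ [] → p *P r ≋ []
  *P-zeroˡ {[]}    r p≋0 = ≋-refl
  *P-zeroˡ {a ∷ p} r p≋0 = begin
    scale a r +P shiftT (p *P r) ≈⟨ +P-cong (scale-≡ r (coeff-≡ p≋0 0)) (shiftT-cong (*P-zeroˡ r (∷-zeroʳ p≋0))) ⟩
    scale 0# r +P shiftT []      ≈⟨ +P-cong (scale-zero r) shiftT-[] ⟩
    []                           ∎
    where open ≋-Reasoning

  *P-zeroʳ : ∀ p → p *P [] ≋ []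
  *P-zeroʳ []      = ≋-refl
  *P-zeroʳ (a ∷ p) = ≋-trans (shiftT-cong (*P-zeroʳ p)) shiftT-[]

  *P-congˡ : ∀ {p p′} r → p ≋ p′ → p *P r ≋ p′ *P r
  *P-congˡ {[]}    {p′}     r e = ≋-sym (*P-zeroˡ r (≋-sym e))
  *P-congˡ {a ∷ p} {[]}     r e = *P-zeroˡ r e
  *P-congˡ {a ∷ p} {b ∷ p′} r e = +P-cong (scale-≡ r (coeff-≡ e 0)) (shiftT-cong (*P-congˡ r (∷-injectiveʳ e)))

  *P-congʳ : ∀ p {r r′} → r ≋ r′ → p *P r ≋ p *P r′
  *P-congʳ []      e = ≋-refl
  *P-congʳ (a ∷ p) e = +P-cong (scale-cong a e) (shiftT-cong (*P-congʳ p e))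

  *P-cong : ∀ {p p′ r r′} → p ≋ p′ → r ≋ r′ → p *P r ≋ p′ *P r′
  *P-cong {p′ = p′} {r} p≋p′ r≋r′ = ≋-trans (*P-congˡ r p≋p′) (*P-congʳ p′ r≋r′)

  *P-identityˡ : ∀ p → oneP *P p ≋ p
  *P-identityˡ p = ≋-trans (+P-cong (scale-one p) shiftT-[]) (+P-identityʳ p)

  shiftT-*P : ∀ p r → shiftT p *P r ≋ shiftT (p *P r)
  shiftT-*P p r = +P-cong (scale-zero r) ≋-refl

  *P-shiftT : ∀ p r → p *P shiftT r ≋ shiftT (p *P r)
  *P-shiftT []      r = ≋-sym shiftT-[]
  *P-shiftT (a ∷ p) r = begin
    scale a (shiftT r) +P shiftT (p *P shiftT r)       ≈⟨ +P-cong (scale-shiftT a r) (shiftT-cong (*P-shiftT p r)) ⟩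
    shiftT (scale a r) +P shiftT (shiftT (p *P r))     ≈⟨ shiftT-+P (scale a r) (shiftT (p *P r)) ⟨
    shiftT (scale a r +P shiftT (p *P r))              ∎
    where open ≋-Reasoning

  *P-constantʳ : ∀ p b → p *P (b ∷ []) ≋ scale b p
  *P-constantʳ []      b = ≋-refl
  *P-constantʳ (a ∷ p) b = ∷-cong (≡.trans (+-identityʳ _) (*-comm a b)) (*P-constantʳ p b)

  *P-distribˡ : ∀ p r s → p *P (r +P s) ≋ (p *P r) +P (p *P s)
  *P-distribˡ []      r s = ≋-refl
  *P-distribˡ (a ∷ p) r s = begin
    scale a (r +P s) +P shiftT (p *P (r +P s))
      ≈⟨ +P-cong (scale-+P a r s) (≋-trans (shiftT-cong (*P-distribˡ p r s)) (shiftT-+P (p *P r) (p *P s))) ⟩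
    (scale a r +P scale a s) +P (shiftT (p *P r) +P shiftT (p *P s))
      ≈⟨ +P-interchange (scale a r) (scale a s) (shiftT (p *P r)) (shiftT (p *P s)) ⟩
    (scale a r +P shiftT (p *P r)) +P (scale a s +P shiftT (p *P s))
      ∎
    where open ≋-Reasoning

  *P-distribʳ : ∀ s p r → (p +P r) *P s ≋ (p *P s) +P (r *P s)
  *P-distribʳ s []      r       = ≋-refl
  *P-distribʳ s (a ∷ p) []      = ≋-sym (+P-identityʳ _)
  *P-distribʳ s (a ∷ p) (b ∷ r) = begin
    scale (a + b) s +P shiftT ((p +P r) *P s)
      ≈⟨ +P-cong (scale-distribʳ a b s) (≋-trans (shiftT-cong (*P-distribʳ s p r)) (shiftT-+P (p *P s) (r *P s))) ⟩
    (scale a s +P scale b s) +P (shiftT (p *P s) +P shiftT (r *P s))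
      ≈⟨ +P-interchange (scale a s) (scale b s) (shiftT (p *P s)) (shiftT (r *P s)) ⟩
    (scale a s +P shiftT (p *P s)) +P (scale b s +P shiftT (r *P s))
      ∎
    where open ≋-Reasoning

  scale-*P : ∀ c p r → scale c p *P r ≋ scale c (p *P r)
  scale-*P c []      r = ≋-refl
  scale-*P c (a ∷ p) r = begin
    scale (c * a) r +P shiftT (scale c p *P r)
      ≈⟨ +P-cong (≋-sym (scale-scale c a r)) (≋-trans (shiftT-cong (scale-*P c p r)) (≋-sym (scale-shiftT c (p *P r)))) ⟩
    scale c (scale a r) +P scale c (shiftT (p *P r))
      ≈⟨ scale-+P c (scale a r) (shiftT (p *P r)) ⟨
    scale c (scale a r +P shiftT (p *P r))
      ∎
    where open ≋-Reasoning

  *P-comm : ∀ p r → p *P r ≋ r *P p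
  *P-comm []      r = ≋-sym (*P-zeroʳ r)
  *P-comm (a ∷ p) r = begin
    scale a r +P shiftT (p *P r)           ≈⟨ +P-cong (≋-sym (*P-constantʳ r a)) (≋-trans (shiftT-cong (*P-comm p r)) (≋-sym (*P-shiftT r p))) ⟩
    (r *P (a ∷ [])) +P (r *P shiftT p)        ≈⟨ *P-distribˡ r (a ∷ []) (shiftT p) ⟨
    r *P ((a ∷ []) +P shiftT p)            ≈⟨ *P-congʳ r (∷-cong (+-identityʳ a) ≋-refl) ⟩
    r *P (a ∷ p)                           ∎
    where open ≋-Reasoning

  *P-assoc : ∀ p r s → (p *P r) *P s ≋ p *P (r *P s)
  *P-assoc []      r s = ≋-refl
  *P-assoc (a ∷ p) r s = begin
    (scale a r +P shiftT (p *P r)) *P s        ≈⟨ *P-distribʳ s (scale a r) (shiftT (p *P r)) ⟩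
    (scale a r *P s) +P (shiftT (p *P r) *P s)    ≈⟨ +P-cong (scale-*P a r s) (≋-trans (shiftT-*P (p *P r) s) (shiftT-cong (*P-assoc p r s))) ⟩
    scale a (r *P s) +P shiftT (p *P (r *P s)) ∎
    where open ≋-Reasoning

  polynomialRing : CommutativeRing 0ℓ 0ℓ
  polynomialRing = record
    { isCommutativeRing = record
      { isRing = record
        { +-isAbelianGroup = +P-isAbelianGroup
        ; *-cong           = *P-cong
        ; *-assoc          = *P-assoc
        ; *-identity       = *P-identityˡ , λ p → ≋-trans (*P-comm p oneP) (*P-identityˡ p)
        ; distrib          = *P-distribˡ , *P-distribʳ
        }
      ; *-comm = *P-comm
      }
    }

module Degree {q : ℕ} (F : FiniteField q) where
  open FieldProperties F
  open PolynomialRing F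

  -- HasDegree and DegreeBelow unfold to statements about coeff, from which Agda cannot
  -- infer the polynomial; hence polynomial arguments are explicit below. Note that
  -- proj₂ of HasDegree p d is exactly DegreeBelow p (suc d).
  DegreeBelow : Pol → ℕ → Set
  DegreeBelow p n = ∀ i → n ≤ i → coeff p i ≡ 0#

  DegreeBelow-mono : ∀ p {m n} → m ≤ n → DegreeBelow p m → DegreeBelow p n
  DegreeBelow-mono p m≤n below i n≤i = below i (ℕ.≤-trans m≤n n≤i)

  HasDegree-cong : ∀ {p r d} → p ≋ r → HasDegree p d → HasDegree r d
  HasDegree-cong {d = d} p≋r (lead≢0 , below) =
    (λ lead≡0 → lead≢0 (≡.trans (coeff-≡ p≋r d) lead≡0)) , λ i d<i → ≡.trans (≡.sym (coeff-≡ p≋r i)) (below i d<i)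

  degree-unique : ∀ p {d e} → HasDegree p d → HasDegree p e → d ≡ e
  degree-unique p {d} {e} (lead-d≢0 , below-d) (lead-e≢0 , below-e) with ℕ.<-cmp d e
  ... | tri< d<e _ _ = ⊥-elim (lead-e≢0 (below-d e d<e))
  ... | tri≈ _ d≡e _ = d≡e
  ... | tri> _ _ e<d = ⊥-elim (lead-d≢0 (below-e d e<d))

  zero⊎degree : ∀ p → p ≋ [] ⊎ Σ ℕ (HasDegree p)
  zero⊎degree []      = inj₁ ≋-refl
  zero⊎degree (a ∷ p) with zero⊎degree p
  ... | inj₂ (d , lead≢0 , below) = inj₂ (suc d , lead≢0 , λ { zero () ; (suc i) (s≤s d<i) → below i d<i })
  ... | inj₁ p≋0 with a ≟ 0#
  ...   | yes a≡0 = inj₁ (coeffwise λ { zero → a≡0 ; (suc i) → coeff-≡ p≋0 i })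
  ...   | no  a≢0 = inj₂ (0 , a≢0 , λ { zero () ; (suc i) _ → coeff-≡ p≋0 i })

  zero-hasNoDegree : ∀ {p d} → p ≋ [] → ¬ HasDegree p d
  zero-hasNoDegree {d = d} p≋0 (lead≢0 , _) = lead≢0 (coeff-≡ p≋0 d)

  degree-+P-dominantʳ : ∀ p r {d} → DegreeBelow p d → HasDegree r d → HasDegree (p +P r) d
  degree-+P-dominantʳ p r {d} p-below (lead≢0 , r-below) =
    (λ lead≡0 → lead≢0 (≡.trans (≡.sym lead-+P) lead≡0)) , below
    where
    lead-+P : coeff (p +P r) d ≡ coeff r d
    lead-+P = ≡.trans (coeff-+P p r d) (≡.trans (cong (_+ coeff r d) (p-below d ℕ.≤-refl)) (+-identityˡ _))
    below : DegreeBelow (p +P r) (suc d)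
    below i d<i = ≡.trans (coeff-+P p r i) (≡.trans (cong₂ _+_ (p-below i (ℕ.<⇒≤ d<i)) (r-below i d<i)) (+-identityˡ 0#))

  degree-+P-dominantˡ : ∀ p r {d} → HasDegree p d → DegreeBelow r d → HasDegree (p +P r) d
  degree-+P-dominantˡ p r hp r-below = HasDegree-cong (+P-comm r p) (degree-+P-dominantʳ r p r-below hp)

  DegreeBelow-scale : ∀ c p {n} → DegreeBelow p n → DegreeBelow (scale c p) n
  DegreeBelow-scale c p below i n≤i = ≡.trans (coeff-scale c p i) (≡.trans (cong (c *_) (below i n≤i)) (zeroʳ c))

  degree-scale : ∀ {c} p {d} → c ≢ 0# → HasDegree p d → HasDegree (scale c p) d
  degree-scale {c} p {d} c≢0 (lead≢0 , below) =
    (λ lead≡0 → *-nonzero c≢0 lead≢0 (≡.trans (≡.sym (coeff-scale c p d)) lead≡0)) , DegreeBelow-scale c p below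

  degree-shiftT : ∀ p {d} → HasDegree p d → HasDegree (shiftT p) (suc d)
  degree-shiftT p (lead≢0 , below) = lead≢0 , λ { zero () ; (suc i) (s≤s d<i) → below i d<i }

  degree-*P : ∀ p r {d e} → HasDegree p d → HasDegree r e → HasDegree (p *P r) (d ℕ.+ e)
  degree-*P []      r (lead≢0 , _) _ = ⊥-elim (lead≢0 refl)
  degree-*P (a ∷ p) r {zero} (a≢0 , below) hr = HasDegree-cong (≋-sym constant-*P) (degree-scale r a≢0 hr)
    where
    p≋0 : p ≋ []
    p≋0 = coeffwise λ i → below (suc i) (s≤s z≤n)
    constant-*P : (a ∷ p) *P r ≋ scale a r
    constant-*P = ≋-trans (+P-cong ≋-refl (≋-trans (shiftT-cong (*P-zeroˡ r p≋0)) shiftT-[])) (+P-identityʳ (scale a r))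
  degree-*P (a ∷ p) r {suc d} {e} (lead≢0 , below) hr =
    degree-+P-dominantʳ (scale a r) (shiftT (p *P r))
      (DegreeBelow-mono (scale a r) (s≤s (ℕ.m≤n+m e d)) (DegreeBelow-scale a r (proj₂ hr)))
      (degree-shiftT (p *P r) (degree-*P p r (lead≢0 , λ i d<i → below (suc i) (s≤s d<i)) hr))

  oneP-degree : HasDegree oneP 0
  oneP-degree = 1≢0 , λ { zero () ; (suc i) _ → refl }

  degree-powP : ∀ β {e} n → HasDegree β e → HasDegree (powP β n) (n ℕ.* e)
  degree-powP β zero    _  = oneP-degree
  degree-powP β (suc n) hβ = degree-*P β (powP β n) hβ (degree-powP β n hβ)

  constant-form : ∀ p → HasDegree p 0 → p ≋ coeff p 0 ∷ []
  constant-form p (_ , below) = coeffwise λ { zero → refl ; (suc i) → below (suc i) (s≤s z≤n) }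

  IsUnit⇒degree0 : ∀ p → IsUnit p → HasDegree p 0
  IsUnit⇒degree0 p (u , pu≈1) with zero⊎degree p | zero⊎degree u
  ... | inj₁ p≋0 | _        = ⊥-elim (0≢1 (≡.trans (≡.sym (coeff-≡ (*P-zeroˡ u p≋0) 0)) (pu≈1 0)))
  ... | inj₂ _   | inj₁ u≋0 = ⊥-elim (0≢1 (≡.trans (≡.sym (coeff-≡ (≋-trans (*P-congʳ p u≋0) (*P-zeroʳ p)) 0)) (pu≈1 0)))
  ... | inj₂ (k , hp) | inj₂ (j , hu) = ≡.subst (HasDegree p) (ℕ.m+n≡0⇒m≡0 k k+j≡0) hp
    where
    k+j≡0 : k ℕ.+ j ≡ 0
    k+j≡0 = degree-unique oneP (HasDegree-cong (coeffwise {p *P u} {oneP} pu≈1) (degree-*P p u hp hu)) oneP-degree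

  degree0⇒IsUnit : ∀ p → HasDegree p 0 → IsUnit p
  degree0⇒IsUnit p hp@(c≢0 , _) = inv c c≢0 ∷ [] , coeff-≡ (begin
    p *P (inv c c≢0 ∷ [])   ≈⟨ *P-constantʳ p (inv c c≢0) ⟩
    scale (inv c c≢0) p     ≈⟨ scale-cong (inv c c≢0) (constant-form p hp) ⟩
    inv c c≢0 * c ∷ []      ≈⟨ ∷-cong (≡.trans (*-comm _ c) (*-inverseʳ c c≢0)) ≋-refl ⟩
    oneP                    ∎)
    where
    c = coeff p 0
    open ≋-Reasoning

module RootCounting {q : ℕ} (F : FiniteField q) where
  open FieldProperties F
  open PolynomialRing F
  open Degree F

  eval : Pol → Carrier → Carrier
  eval []      x = 0#
  eval (a ∷ p) x = a + x * eval p x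

  eval-+P : ∀ p r x → eval (p +P r) x ≡ eval p x + eval r x
  eval-+P []      r       x = ≡.sym (+-identityˡ _)
  eval-+P (a ∷ p) []      x = ≡.sym (+-identityʳ _)
  eval-+P (a ∷ p) (b ∷ r) x = begin
    a + b + x * eval (p +P r) x                  ≡⟨ cong (λ e → a + b + x * e) (eval-+P p r x) ⟩
    a + b + x * (eval p x + eval r x)            ≡⟨ cong (a + b +_) (distribˡ x _ _) ⟩
    a + b + (x * eval p x + x * eval r x)        ≡⟨ +-interchange a b _ _ ⟩
    a + x * eval p x + (b + x * eval r x)        ∎
    where open ≡.≡-Reasoning

  eval-zero : ∀ p x → p ≋ [] → eval p x ≡ 0#
  eval-zero []      x p≋0 = refl
  eval-zero (a ∷ p) x p≋0 =
    ≡.trans (cong₂ (λ c e → c + x * e) (coeff-≡ p≋0 0) (eval-zero p x (∷-zeroʳ p≋0))) (≡.trans (+-identityˡ _) (zeroʳ x))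

  -- Synthetic division by X − a; eval-quotient is p(x) − p(a) = (x − a)·Q(x) with the
  -- terms moved so that no subtraction occurs.
  quotient : Carrier → Pol → Pol
  quotient a []      = []
  quotient a (c ∷ p) = eval p a ∷ quotient a p

  eval-quotient : ∀ a p x → eval p x + a * eval (quotient a p) x ≡ x * eval (quotient a p) x + eval p a
  eval-quotient a []      x = ≡.trans (+-identityˡ _) (≡.trans (zeroʳ a) (≡.sym (≡.trans (+-identityʳ _) (zeroʳ x))))
  eval-quotient a (c ∷ p) x = begin
    c + x * E + a * (u + x * Q)          ≡⟨ cong (c + x * E +_) (≡.trans (distribˡ a u _) (cong (a * u +_) (x∙yz≈y∙xz a x Q))) ⟩
    c + x * E + (a * u + x * (a * Q))    ≡⟨ +-interchange c _ _ _ ⟩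
    c + a * u + (x * E + x * (a * Q))    ≡⟨ cong (c + a * u +_) (distribˡ x E _) ⟨
    c + a * u + x * (E + a * Q)          ≡⟨ cong (λ e → c + a * u + x * e) (eval-quotient a p x) ⟩
    c + a * u + x * (x * Q + u)          ≡⟨ +-comm _ _ ⟩
    x * (x * Q + u) + (c + a * u)        ≡⟨ cong (λ e → x * e + (c + a * u)) (+-comm _ u) ⟩
    x * (u + x * Q) + (c + a * u)        ∎
    where
    open ≡.≡-Reasoning
    E = eval p x
    Q = eval (quotient a p) x
    u = eval p a

  DegreeBelow-quotient : ∀ a p n → DegreeBelow p (suc n) → DegreeBelow (quotient a p) n
  DegreeBelow-quotient a []      n       below i       _       = refl
  DegreeBelow-quotient a (c ∷ p) zero    below zero    _       = eval-zero p a (coeffwise λ j → below (suc j) (s≤s z≤n))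
  DegreeBelow-quotient a (c ∷ p) zero    below (suc i) _       =
    DegreeBelow-quotient a p zero (λ j _ → below (suc j) (s≤s z≤n)) i z≤n
  DegreeBelow-quotient a (c ∷ p) (suc n) below (suc i) (s≤s n≤i) =
    DegreeBelow-quotient a p n (λ j n<j → below (suc j) (s≤s n<j)) i n≤i

  quotient-zero : ∀ a p → quotient a p ≋ [] → eval p a ≡ 0# → p ≋ []
  quotient-zero a []      _    _      = ≋-refl
  quotient-zero a (c ∷ p) quot≋0 root = coeffwise λ { zero → c≡0 ; (suc i) → coeff-≡ p≋0 i }
    where
    p≋0 : p ≋ []
    p≋0 = quotient-zero a p (∷-zeroʳ quot≋0) (coeff-≡ quot≋0 0)
    c≡0 : c ≡ 0#
    c≡0 = begin
      c                  ≡⟨ +-identityʳ c ⟨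
      c + 0#             ≡⟨ cong (c +_) (zeroʳ a) ⟨
      c + a * 0#         ≡⟨ cong (λ e → c + a * e) (eval-zero p a p≋0) ⟨
      c + a * eval p a   ≡⟨ root ⟩
      0#                 ∎
      where open ≡.≡-Reasoning

  distinctRoots⇒zero : ∀ n (xs : Fin n → Carrier) → Injective _≡_ _≡_ xs → ∀ p → DegreeBelow p n
                     → (∀ j → eval p (xs j) ≡ 0#) → p ≋ []
  distinctRoots⇒zero zero    xs _      p below _     = coeffwise λ i → below i z≤n
  distinctRoots⇒zero (suc n) xs xs-inj p below roots = quotient-zero a p quotient≋0 (roots Fin.zero)
    where
    a = xs Fin.zero
    quotient-root : ∀ j → eval (quotient a p) (xs (Fin.suc j)) ≡ 0#
    quotient-root j with eval (quotient a p) (xs (Fin.suc j)) ≟ 0#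
    ... | yes Q≡0 = Q≡0
    ... | no  Q≢0 = ⊥-elim (Fin.0≢1+n (xs-inj (*-cancelʳ Q≢0 aQ≡xQ)))
      where
      x = xs (Fin.suc j)
      aQ≡xQ : a * eval (quotient a p) x ≡ x * eval (quotient a p) x
      aQ≡xQ = begin
        a * eval (quotient a p) x                   ≡⟨ +-identityˡ _ ⟨
        0# + a * eval (quotient a p) x              ≡⟨ cong (_+ a * eval (quotient a p) x) (roots (Fin.suc j)) ⟨
        eval p x + a * eval (quotient a p) x        ≡⟨ eval-quotient a p x ⟩
        x * eval (quotient a p) x + eval p a        ≡⟨ cong (x * eval (quotient a p) x +_) (roots Fin.zero) ⟩
        x * eval (quotient a p) x + 0#              ≡⟨ +-identityʳ _ ⟩
        x * eval (quotient a p) x                   ∎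
        where open ≡.≡-Reasoning
    quotient≋0 : quotient a p ≋ []
    quotient≋0 = distinctRoots⇒zero n (xs ∘ Fin.suc) (Fin.suc-injective ∘ xs-inj) (quotient a p)
                   (DegreeBelow-quotient a p n below) quotient-root

module Frobenius {q : ℕ} (F : FiniteField q) where
  open FieldProperties F
  open PolynomialRing F
  open Degree F
  open RootCounting F
  open SemiringSum semiring using ()
    renaming (sum to ∑; *-distribˡ-sum to *-distribˡ-∑; sum-init-last to ∑-init-last; sum-cong-≗ to ∑-cong)
  open SemiringMult semiring using () renaming (_×_ to _·_; ×-assoc-* to ·-assoc-*)
  open CommutativeSemiringBinomial commutativeSemiring using (binomialTerm) renaming (theorem to binomial-theorem)

  ·-one : ∀ n y → n · y ≡ (n · 1#) * y
  ·-one n y = ≡.sym (≡.trans (·-assoc-* n 1# y) (cong (n ·_) (*-identityˡ y)))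

  ^-oneˡ : ∀ n → 1# ^ n ≡ 1#
  ^-oneˡ zero    = refl
  ^-oneˡ (suc n) = ≡.trans (*-identityˡ _) (^-oneˡ n)

  fromCoefficients : ℕ → (ℕ → Carrier) → Pol
  fromCoefficients zero    c = []
  fromCoefficients (suc n) c = c 0 ∷ fromCoefficients n (c ∘ suc)

  coeff-fromCoefficients : ∀ n c {i} → i < n → coeff (fromCoefficients n c) i ≡ c i
  coeff-fromCoefficients (suc n) c {zero}  _         = refl
  coeff-fromCoefficients (suc n) c {suc i} (s≤s i<n) = coeff-fromCoefficients n (c ∘ suc) i<n

  DegreeBelow-fromCoefficients : ∀ n c → DegreeBelow (fromCoefficients n c) n
  DegreeBelow-fromCoefficients zero    c i       _         = refl
  DegreeBelow-fromCoefficients (suc n) c (suc i) (s≤s n≤i) = DegreeBelow-fromCoefficients n (c ∘ suc) i n≤i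

  eval-fromCoefficients : ∀ n c x → eval (fromCoefficients n c) x ≡ ∑ {n} (λ k → c (toℕ k) * x ^ toℕ k)
  eval-fromCoefficients zero    c x = refl
  eval-fromCoefficients (suc n) c x = cong₂ _+_ (≡.sym (*-identityʳ (c 0))) (begin
    x * eval (fromCoefficients n (c ∘ suc)) x          ≡⟨ cong (x *_) (eval-fromCoefficients n (c ∘ suc) x) ⟩
    x * ∑ {n} (λ k → c (suc (toℕ k)) * x ^ toℕ k)      ≡⟨ *-distribˡ-∑ {n} x _ ⟩
    ∑ {n} (λ k → x * (c (suc (toℕ k)) * x ^ toℕ k))    ≡⟨ ∑-cong {n} (λ k → x∙yz≈y∙xz x (c (suc (toℕ k))) (x ^ toℕ k)) ⟩
    ∑ {n} (λ k → c (suc (toℕ k)) * x ^ suc (toℕ k))    ∎)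
    where open ≡.≡-Reasoning

  choose : ℕ → Carrier
  choose k = (q C k) · 1#

  binomial-sum : ∀ x → ∑ {q} (λ k → choose (toℕ k) * x ^ toℕ k) ≡ 1#
  binomial-sum x = GroupProperties.∙-cancelʳ +-group x _ _ (begin
    ∑ {q} (λ k → choose (toℕ k) * x ^ toℕ k) + x   ≡⟨ cong₂ _+_ (∑-cong {q} inner) outer ⟨
    ∑ {q} (t ∘ inject₁) + t (fromℕ q)              ≡⟨ ∑-init-last t ⟨
    ∑ t                                            ≡⟨ binomial-theorem q x 1# ⟨
    (x + 1#) ^ q                                   ≡⟨ fermat (x + 1#) ⟩
    x + 1#                                         ≡⟨ +-comm x 1# ⟩
    1# + x                                         ∎)
    where
    open ≡.≡-Reasoning
    t = binomialTerm x 1# q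
    term : ∀ m → (q C m) · (x ^ m * 1# ^ (q ∸ m)) ≡ choose m * x ^ m
    term m = ≡.trans (cong ((q C m) ·_) (≡.trans (cong (x ^ m *_) (^-oneˡ (q ∸ m))) (*-identityʳ _))) (·-one (q C m) (x ^ m))
    inner : ∀ k → t (inject₁ k) ≡ choose (toℕ k) * x ^ toℕ k
    inner k = ≡.trans (cong (λ m → (q C m) · (x ^ m * 1# ^ (q ∸ m))) (Fin.toℕ-inject₁ k)) (term (toℕ k))
    outer : t (fromℕ q) ≡ x
    outer = begin
      t (fromℕ q)                        ≡⟨ cong (λ m → (q C m) · (x ^ m * 1# ^ (q ∸ m))) (Fin.toℕ-fromℕ q) ⟩
      (q C q) · (x ^ q * 1# ^ (q ∸ q))   ≡⟨ cong₂ (λ n e → n · (x ^ q * e)) (nCn≡1 q) (^-oneˡ (q ∸ q)) ⟩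
      1 · (x ^ q * 1#)                   ≡⟨ ≡.trans (+-identityʳ _) (*-identityʳ _) ⟩
      x ^ q                              ≡⟨ fermat x ⟩
      x                                  ∎

  -- By binomial-sum, Σ_{k<q} choose k · X^k − 1 has degree < q and vanishes on all of F.
  binomials-vanish : ∀ k → 0 < k → k < q → choose k ≡ 0#
  binomials-vanish (suc j) _ k<q = begin
    choose (suc j)                                 ≡⟨ coeff-fromCoefficients q choose k<q ⟨
    coeff (fromCoefficients q choose) (suc j)      ≡⟨ +-identityʳ _ ⟨
    coeff (fromCoefficients q choose) (suc j) + 0# ≡⟨ coeff-+P (fromCoefficients q choose) (negP oneP) (suc j) ⟨
    coeff R (suc j)                                ≡⟨ coeff-≡ R≋0 (suc j) ⟩
    0#                                             ∎
    where
    open ≡.≡-Reasoning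
    R : Pol
    R = fromCoefficients q choose +P negP oneP
    root : ∀ x → eval R x ≡ 0#
    root x = begin
      eval R x                                              ≡⟨ eval-+P (fromCoefficients q choose) (negP oneP) x ⟩
      eval (fromCoefficients q choose) x + (- 1# + x * 0#)  ≡⟨ cong₂ _+_ (≡.trans (eval-fromCoefficients q choose x) (binomial-sum x))
                                                                         (≡.trans (cong (- 1# +_) (zeroʳ x)) (+-identityʳ _)) ⟩
      1# + - 1#                                             ≡⟨ -‿inverseʳ 1# ⟩
      0#                                                    ∎
    below : DegreeBelow R q
    below zero    q≤0 = ⊥-elim (ℕ.≢-nonZero⁻¹ q {{q-nonZero}} (ℕ.n≤0⇒n≡0 q≤0))
    below (suc i) q≤i = ≡.trans (coeff-+P (fromCoefficients q choose) (negP oneP) (suc i))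
                                (≡.trans (+-identityʳ _) (DegreeBelow-fromCoefficients q choose (suc i) q≤i))
    R≋0 : R ≋ []
    R≋0 = distinctRoots⇒zero q enumerate enumerate-injective R below (root ∘ enumerate)

  private
    module PolynomialSum = SemiringSum (CommutativeRing.semiring polynomialRing)
    module PolynomialMult = SemiringMult (CommutativeRing.semiring polynomialRing)
    module PolynomialExp = SemiringExp (CommutativeRing.semiring polynomialRing)
    module PolynomialBinomial = CommutativeSemiringBinomial (CommutativeRing.commutativeSemiring polynomialRing)
    open PolynomialMult using () renaming (_×_ to _×P_)
    open PolynomialExp using () renaming (_^_ to _^P_)

  powP≋^ : ∀ β n → powP β n ≋ (β ^P n)
  powP≋^ β zero    = ≋-refl
  powP≋^ β (suc n) = *P-congʳ β (powP≋^ β n)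

  ×-scale : ∀ n p → n ×P p ≋ scale (n · 1#) p
  ×-scale zero    p = ≋-sym (scale-zero p)
  ×-scale (suc n) p = begin
    p +P (n ×P p)                       ≈⟨ +P-cong (≋-sym (scale-one p)) (×-scale n p) ⟩
    scale 1# p +P scale (n · 1#) p     ≈⟨ scale-distribʳ 1# (n · 1#) p ⟨
    scale (suc n · 1#) p               ∎
    where open ≋-Reasoning

  frobenius-exponent : ∀ N → 0 < N → (∀ k → 0 < k → k < N → (N C k) · 1# ≡ 0#)
                     → ∀ β γ → powP (β +P γ) N ≋ powP β N +P powP γ N
  frobenius-exponent (suc n) _ vanish β γ = begin
    powP (β +P γ) N                                      ≈⟨ powP≋^ (β +P γ) N ⟩
    ((β +P γ) ^P N)                                      ≈⟨ PolynomialBinomial.theorem N β γ ⟩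
    t Fin.zero +P PolynomialSum.sum (t ∘ Fin.suc)        ≈⟨ +P-cong (≋-refl {t Fin.zero}) (PolynomialSum.sum-init-last (t ∘ Fin.suc)) ⟩
    t Fin.zero +P (PolynomialSum.sum (t ∘ Fin.suc ∘ inject₁) +P t (fromℕ N))
                                                         ≈⟨ +P-cong first (+P-cong middle last) ⟩
    (γ ^P N) +P (β ^P N)                                 ≈⟨ +P-comm (γ ^P N) (β ^P N) ⟩
    (β ^P N) +P (γ ^P N)                                 ≈⟨ +P-cong (powP≋^ β N) (powP≋^ γ N) ⟨
    powP β N +P powP γ N                                 ∎
    where
    open ≋-Reasoning
    N = suc n
    t = PolynomialBinomial.binomialTerm β γ N
    first : t Fin.zero ≋ (γ ^P N)
    first = ≋-trans (+P-identityʳ _) (*P-identityˡ (γ ^P N))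
    middle : PolynomialSum.sum (t ∘ Fin.suc ∘ inject₁) ≋ []
    middle = ≋-trans (PolynomialSum.sum-cong-≋ vanishing-term) (PolynomialSum.sum-replicate-zero n)
      where
      vanishing-term : ∀ j → t (Fin.suc (inject₁ j)) ≋ []
      vanishing-term j = begin
        (N C k) ×P b              ≈⟨ ×-scale (N C k) b ⟩
        scale ((N C k) · 1#) b    ≈⟨ scale-≡ b (vanish k (s≤s z≤n) (s≤s (Fin.inject₁ℕ< j))) ⟩
        scale 0# b                ≈⟨ scale-zero b ⟩
        []                        ∎
        where
        k = suc (toℕ (inject₁ j))
        b = PolynomialBinomial.binomial β γ N (Fin.suc (inject₁ j))
    last : t (fromℕ N) ≋ (β ^P N)
    last = begin
      t (fromℕ N)                               ≈⟨ ≋-reflexive (cong (λ m → (N C m) ×P ((β ^P m) *P (γ ^P (N ∸ m)))) (Fin.toℕ-fromℕ N)) ⟩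
      (N C N) ×P ((β ^P N) *P (γ ^P (N ∸ N)))   ≈⟨ ≋-reflexive (cong₂ (λ k m → k ×P ((β ^P N) *P (γ ^P m))) (nCn≡1 N) (ℕ.n∸n≡0 N)) ⟩
      ((β ^P N) *P oneP) +P []                  ≈⟨ +P-identityʳ _ ⟩
      (β ^P N) *P oneP                          ≈⟨ *P-comm (β ^P N) oneP ⟩
      oneP *P (β ^P N)                          ≈⟨ *P-identityˡ (β ^P N) ⟩
      (β ^P N)                                  ∎

  frobenius : ∀ β γ → powP (β +P γ) q ≋ powP β q +P powP γ q
  frobenius = frobenius-exponent q (ℕ.>-nonZero⁻¹ q {{q-nonZero}}) binomials-vanish

module CarlitzAction {q : ℕ} (F : FiniteField q) where
  open FieldProperties F
  open PolynomialRing F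
  open Frobenius F using (frobenius)

  powP-cong : ∀ {β γ} n → β ≋ γ → powP β n ≋ powP γ n
  powP-cong zero    β≋γ = ≋-refl
  powP-cong (suc n) β≋γ = *P-cong β≋γ (powP-cong n β≋γ)

  powP-scale : ∀ c β n → powP (scale c β) n ≋ scale (c ^ n) (powP β n)
  powP-scale c β zero    = ≋-sym (scale-one oneP)
  powP-scale c β (suc n) = begin
    scale c β *P powP (scale c β) n              ≈⟨ *P-congʳ (scale c β) (powP-scale c β n) ⟩
    scale c β *P scale (c ^ n) (powP β n)        ≈⟨ scale-*P c β _ ⟩
    scale c (β *P scale (c ^ n) (powP β n))      ≈⟨ scale-cong c (*P-comm β _) ⟩
    scale c (scale (c ^ n) (powP β n) *P β)      ≈⟨ scale-cong c (scale-*P (c ^ n) (powP β n) β) ⟩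
    scale c (scale (c ^ n) (powP β n *P β))      ≈⟨ scale-scale c (c ^ n) _ ⟩
    scale (c * c ^ n) (powP β n *P β)            ≈⟨ scale-cong (c * c ^ n) (*P-comm (powP β n) β) ⟩
    scale (c * c ^ n) (β *P powP β n)            ∎
    where open ≋-Reasoning

  carlitzT-cong : ∀ {β γ} → β ≋ γ → carlitzT β ≋ carlitzT γ
  carlitzT-cong β≋γ = +P-cong (shiftT-cong β≋γ) (powP-cong q β≋γ)

  carlitzT-+P : ∀ β γ → carlitzT (β +P γ) ≋ carlitzT β +P carlitzT γ
  carlitzT-+P β γ = begin
    shiftT (β +P γ) +P powP (β +P γ) q                        ≈⟨ +P-cong (shiftT-+P β γ) (frobenius β γ) ⟩
    (shiftT β +P shiftT γ) +P (powP β q +P powP γ q)          ≈⟨ +P-interchange (shiftT β) (shiftT γ) (powP β q) (powP γ q) ⟩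
    carlitzT β +P carlitzT γ                                  ∎
    where open ≋-Reasoning

  carlitzT-scale : ∀ c β → carlitzT (scale c β) ≋ scale c (carlitzT β)
  carlitzT-scale c β = begin
    shiftT (scale c β) +P powP (scale c β) q                  ≈⟨ +P-cong (≋-sym (scale-shiftT c β)) (powP-scale c β q) ⟩
    scale c (shiftT β) +P scale (c ^ q) (powP β q)            ≈⟨ +P-cong ≋-refl (scale-≡ (powP β q) (fermat c)) ⟩
    scale c (shiftT β) +P scale c (powP β q)                  ≈⟨ scale-+P c (shiftT β) (powP β q) ⟨
    scale c (carlitzT β)                                      ∎
    where open ≋-Reasoning

  carlitzT-[] : carlitzT [] ≋ []
  carlitzT-[] = +P-cong shiftT-[] (≋-reflexive (powP-[] q {{q-nonZero}}))
    where
    powP-[] : ∀ n → .{{ℕ.NonZero n}} → powP [] n ≡ []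
    powP-[] (suc n) = refl

  carlitz-zeroˡ : ∀ {m} β → m ≋ [] → carlitz m β ≋ []
  carlitz-zeroˡ {[]}    β _   = ≋-refl
  carlitz-zeroˡ {a ∷ m} β m≋0 =
    +P-cong (≋-trans (scale-≡ β (coeff-≡ m≋0 0)) (scale-zero β)) (carlitz-zeroˡ (carlitzT β) (∷-zeroʳ m≋0))

  carlitz-congˡ : ∀ {m n} β → m ≋ n → carlitz m β ≋ carlitz n β
  carlitz-congˡ {[]}    {n}     β m≋n = ≋-sym (carlitz-zeroˡ β (≋-sym m≋n))
  carlitz-congˡ {a ∷ m} {[]}    β m≋n = carlitz-zeroˡ β m≋n
  carlitz-congˡ {a ∷ m} {b ∷ n} β m≋n =
    +P-cong (scale-≡ β (coeff-≡ m≋n 0)) (carlitz-congˡ (carlitzT β) (∷-injectiveʳ m≋n))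

  carlitz-congʳ : ∀ m {β γ} → β ≋ γ → carlitz m β ≋ carlitz m γ
  carlitz-congʳ []      β≋γ = ≋-refl
  carlitz-congʳ (a ∷ m) β≋γ = +P-cong (scale-cong a β≋γ) (carlitz-congʳ m (carlitzT-cong β≋γ))

  carlitz-+P : ∀ m n β → carlitz (m +P n) β ≋ carlitz m β +P carlitz n β
  carlitz-+P []      n       β = ≋-refl
  carlitz-+P (a ∷ m) []      β = ≋-sym (+P-identityʳ _)
  carlitz-+P (a ∷ m) (b ∷ n) β = begin
    scale (a + b) β +P carlitz (m +P n) (carlitzT β)
      ≈⟨ +P-cong (scale-distribʳ a b β) (carlitz-+P m n (carlitzT β)) ⟩
    (scale a β +P scale b β) +P (carlitz m (carlitzT β) +P carlitz n (carlitzT β))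
      ≈⟨ +P-interchange (scale a β) (scale b β) (carlitz m (carlitzT β)) (carlitz n (carlitzT β)) ⟩
    carlitz (a ∷ m) β +P carlitz (b ∷ n) β
      ∎
    where open ≋-Reasoning

  carlitz-scale : ∀ c m β → carlitz (scale c m) β ≋ scale c (carlitz m β)
  carlitz-scale c []      β = ≋-refl
  carlitz-scale c (a ∷ m) β = begin
    scale (c * a) β +P carlitz (scale c m) (carlitzT β)
      ≈⟨ +P-cong (≋-sym (scale-scale c a β)) (carlitz-scale c m (carlitzT β)) ⟩
    scale c (scale a β) +P scale c (carlitz m (carlitzT β))
      ≈⟨ scale-+P c (scale a β) (carlitz m (carlitzT β)) ⟨
    scale c (carlitz (a ∷ m) β)
      ∎
    where open ≋-Reasoning

  carlitz-shiftT : ∀ m β → carlitz (shiftT m) β ≋ carlitz m (carlitzT β)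
  carlitz-shiftT m β = +P-cong (scale-zero β) ≋-refl

  carlitz-carlitzT : ∀ m β → carlitz m (carlitzT β) ≋ carlitzT (carlitz m β)
  carlitz-carlitzT []      β = ≋-sym carlitzT-[]
  carlitz-carlitzT (a ∷ m) β = begin
    scale a (carlitzT β) +P carlitz m (carlitzT (carlitzT β))
      ≈⟨ +P-cong (≋-sym (carlitzT-scale a β)) (carlitz-carlitzT m (carlitzT β)) ⟩
    carlitzT (scale a β) +P carlitzT (carlitz m (carlitzT β))
      ≈⟨ carlitzT-+P (scale a β) (carlitz m (carlitzT β)) ⟨
    carlitzT (carlitz (a ∷ m) β)
      ∎
    where open ≋-Reasoning

  carlitz-*P : ∀ a b β → carlitz (a *P b) β ≋ carlitz a (carlitz b β)
  carlitz-*P []      b β = ≋-refl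
  carlitz-*P (x ∷ a) b β = begin
    carlitz (scale x b +P shiftT (a *P b)) β
      ≈⟨ carlitz-+P (scale x b) (shiftT (a *P b)) β ⟩
    carlitz (scale x b) β +P carlitz (shiftT (a *P b)) β
      ≈⟨ +P-cong (carlitz-scale x b β) (≋-trans (carlitz-shiftT (a *P b) β) (carlitz-*P a b (carlitzT β))) ⟩
    scale x (carlitz b β) +P carlitz a (carlitz b (carlitzT β))
      ≈⟨ +P-cong ≋-refl (carlitz-congʳ a (carlitz-carlitzT b β)) ⟩
    carlitz (x ∷ a) (carlitz b β)
      ∎
    where open ≋-Reasoning

  carlitzT-cofactor : Pol → Pol
  carlitzT-cofactor β = shiftT oneP +P powP β (q ∸ 1)

  carlitzT-factor : ∀ β → carlitzT β ≋ β *P carlitzT-cofactor β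
  carlitzT-factor β = begin
    shiftT β +P powP β q                                 ≈⟨ +P-cong shiftT≋ (≋-reflexive (powP-pred q {{q-nonZero}})) ⟩
    (β *P shiftT oneP) +P (β *P powP β (q ∸ 1))          ≈⟨ *P-distribˡ β (shiftT oneP) (powP β (q ∸ 1)) ⟨
    β *P carlitzT-cofactor β                             ∎
    where
    open ≋-Reasoning
    shiftT≋ : shiftT β ≋ β *P shiftT oneP
    shiftT≋ = ≋-sym (≋-trans (*P-shiftT β oneP) (shiftT-cong (≋-trans (*P-comm β oneP) (*P-identityˡ β))))
    powP-pred : ∀ n → .{{ℕ.NonZero n}} → powP β n ≡ β *P powP β (n ∸ 1)
    powP-pred (suc n) = refl

  cofactor : Pol → Pol → Pol
  cofactor []      β = []
  cofactor (a ∷ m) β = (a ∷ []) +P (carlitzT-cofactor β *P cofactor m (carlitzT β))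

  carlitz-factor : ∀ m β → carlitz m β ≋ β *P cofactor m β
  carlitz-factor []      β = ≋-sym (*P-zeroʳ β)
  carlitz-factor (a ∷ m) β = begin
    scale a β +P carlitz m (carlitzT β)
      ≈⟨ +P-cong (≋-sym (*P-constantʳ β a)) (carlitz-factor m (carlitzT β)) ⟩
    (β *P (a ∷ [])) +P (carlitzT β *P cofactor m (carlitzT β))
      ≈⟨ +P-cong ≋-refl (≋-trans (*P-congˡ _ (carlitzT-factor β)) (*P-assoc β _ _)) ⟩
    (β *P (a ∷ [])) +P (β *P (carlitzT-cofactor β *P cofactor m (carlitzT β)))
      ≈⟨ *P-distribˡ β (a ∷ []) _ ⟨
    β *P cofactor (a ∷ m) β
      ∎
    where open ≋-Reasoning

module CarlitzDegree {q : ℕ} (F : FiniteField q) (q≥3 : 3 ≤ q) where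
  open FieldProperties F
  open PolynomialRing F
  open Degree F
  open CarlitzAction F using (carlitz-zeroˡ)

  degCarlitzT : ℕ → ℕ
  degCarlitzT zero    = 1
  degCarlitzT (suc e) = q ℕ.* suc e

  degCarlitz : ℕ → ℕ → ℕ
  degCarlitz zero    e = e
  degCarlitz (suc d) e = degCarlitz d (degCarlitzT e)

  <-degCarlitzT : ∀ e → e < degCarlitzT e
  <-degCarlitzT zero    = s≤s z≤n
  <-degCarlitzT (suc e) =
    ℕ.<-≤-trans (ℕ.m<m*n (suc e) q (ℕ.≤-trans (s≤s (s≤s z≤n)) q≥3)) (ℕ.≤-reflexive (ℕ.*-comm (suc e) q))

  ≤-degCarlitz : ∀ d e → e ≤ degCarlitz d e
  ≤-degCarlitz zero    e = ℕ.≤-refl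
  ≤-degCarlitz (suc d) e = ℕ.≤-trans (ℕ.<⇒≤ (<-degCarlitzT e)) (≤-degCarlitz d (degCarlitzT e))

  <-degCarlitz : ∀ d e → e < degCarlitz (suc d) e
  <-degCarlitz d e = ℕ.<-≤-trans (<-degCarlitzT e) (≤-degCarlitz d (degCarlitzT e))

  degree-carlitzT : ∀ β {e} → HasDegree β e → HasDegree (carlitzT β) (degCarlitzT e)
  degree-carlitzT β {zero} hβ =
    degree-+P-dominantˡ (shiftT β) (powP β q) (degree-shiftT β hβ)
      (≡.subst (λ n → DegreeBelow (powP β q) (suc n)) (ℕ.*-zeroʳ q) (proj₂ (degree-powP β q hβ)))
  degree-carlitzT β {suc e} hβ =
    degree-+P-dominantʳ (shiftT β) (powP β q)
      (DegreeBelow-mono (shiftT β) 3+e≤q*[1+e] (proj₂ (degree-shiftT β hβ))) (degree-powP β q hβ)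
    where
    3+e≤q*[1+e] : 3 ℕ.+ e ≤ q ℕ.* suc e
    3+e≤q*[1+e] = begin
      3 ℕ.+ e         ≤⟨ ℕ.+-monoʳ-≤ 3 (ℕ.m≤n*m e 3) ⟩
      3 ℕ.+ 3 ℕ.* e   ≡⟨ ℕ.*-suc 3 e ⟨
      3 ℕ.* suc e     ≤⟨ ℕ.*-monoˡ-≤ (suc e) q≥3 ⟩
      q ℕ.* suc e     ∎
      where open ℕ.≤-Reasoning

  degree-carlitz : ∀ m β {d e} → HasDegree m d → HasDegree β e → HasDegree (carlitz m β) (degCarlitz d e)
  degree-carlitz []      β (lead≢0 , _) _ = ⊥-elim (lead≢0 refl)
  degree-carlitz (a ∷ m) β {zero} (a≢0 , below) hβ =
    HasDegree-cong (≋-sym (≋-trans (+P-cong ≋-refl (carlitz-zeroˡ (carlitzT β) m≋0)) (+P-identityʳ (scale a β))))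
      (degree-scale β a≢0 hβ)
    where
    m≋0 : m ≋ []
    m≋0 = coeffwise λ i → below (suc i) (s≤s z≤n)
  degree-carlitz (a ∷ m) β {suc d} {e} (lead≢0 , below) hβ =
    degree-+P-dominantʳ (scale a β) (carlitz m (carlitzT β))
      (DegreeBelow-mono (scale a β) (<-degCarlitz d e) (DegreeBelow-scale a β (proj₂ hβ)))
      (degree-carlitz m (carlitzT β) (lead≢0 , λ i d<i → below (suc i) (s≤s d<i)) (degree-carlitzT β hβ))

module IrreducibleCarlitzValues {q : ℕ} (F : FiniteField q) (q≥3 : 3 ≤ q) where
  open PolynomialRing F
  open Degree F
  open CarlitzAction F using (carlitz-congˡ; carlitz-*P; cofactor; carlitz-factor)
  open CarlitzDegree F q≥3

  Irreducible : Pol → Set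
  Irreducible p = (a b : Pol) → p ≈P (a *P b) → IsUnit a ⊎ IsUnit b

  irreducible⇒noProperFactor : ∀ {P Z} y z {Y} → Irreducible P → HasDegree P Z → HasDegree y Y
                             → 0 < Y → Y < Z → P ≋ y *P z → ⊥
  irreducible⇒noProperFactor y z {Y} irreducible hP hy 0<Y Y<Z P≋yz with irreducible y z (coeff-≡ P≋yz)
  ... | inj₁ y-unit = ℕ.<⇒≢ 0<Y (degree-unique y (IsUnit⇒degree0 y y-unit) hy)
  ... | inj₂ z-unit = ℕ.<⇒≢ Y<Z (≡.trans (≡.sym (ℕ.+-identityʳ Y))
                                  (degree-unique (y *P z) (degree-*P y z hy (IsUnit⇒degree0 z z-unit)) (HasDegree-cong P≋yz hP)))

  irreducible-carlitz⇒constant : ∀ m α {d h} → HasDegree m (suc d) → HasDegree α h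
                               → Irreducible (carlitz m α) → NonzeroConstant α
  irreducible-carlitz⇒constant m α {h = zero} _ hα _ = coeff α 0 , proj₁ hα , coeff-≡ (constant-form α hα)
  irreducible-carlitz⇒constant m α {d} {suc h} hm hα irreducible =
    ⊥-elim (irreducible⇒noProperFactor α (cofactor m α) irreducible (degree-carlitz m α hm hα) hα
              (s≤s z≤n) (<-degCarlitz d (suc h)) (carlitz-factor m α))

  irreducible-carlitz⇒irreducible : ∀ m α {d h} → HasDegree m (suc d) → HasDegree α h
                                  → Irreducible (carlitz m α) → Irreducible m
  irreducible-carlitz⇒irreducible m α {h = h} hm hα irreducible a b m≈ab = cases (zero⊎degree a) (zero⊎degree b)
    where
    m≋ab : m ≋ a *P b
    m≋ab = coeffwise m≈ab
    cases : a ≋ [] ⊎ Σ ℕ (HasDegree a) → b ≋ [] ⊎ Σ ℕ (HasDegree b) → IsUnit a ⊎ IsUnit b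
    cases (inj₁ a≋0)         _                  = ⊥-elim (zero-hasNoDegree (≋-trans m≋ab (*P-zeroˡ b a≋0)) hm)
    cases (inj₂ _)           (inj₁ b≋0)         = ⊥-elim (zero-hasNoDegree (≋-trans m≋ab (≋-trans (*P-congʳ a b≋0) (*P-zeroʳ a))) hm)
    cases (inj₂ (zero , ha)) (inj₂ _)           = inj₁ (degree0⇒IsUnit a ha)
    cases (inj₂ (suc _ , _)) (inj₂ (zero , hb)) = inj₂ (degree0⇒IsUnit b hb)
    cases (inj₂ (suc r , ha)) (inj₂ (suc s , hb)) =
      ⊥-elim (irreducible⇒noProperFactor y (cofactor a y) irreducible hP hy
                (ℕ.≤-<-trans z≤n (<-degCarlitz s h)) (<-degCarlitz r _) (≋-trans composite (carlitz-factor a y)))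
      where
      y = carlitz b α
      hy : HasDegree y (degCarlitz (suc s) h)
      hy = degree-carlitz b α hb hα
      composite : carlitz m α ≋ carlitz a y
      composite = ≋-trans (carlitz-congˡ α m≋ab) (carlitz-*P a b α)
      hP : HasDegree (carlitz m α) (degCarlitz (suc r) (degCarlitz (suc s) h))
      hP = HasDegree-cong (≋-sym composite) (degree-carlitz a y ha hy)

lemma2p1 : (q : ℕ) → 3 ≤ q → (F : FiniteField q) → (m α : Poly.Pol F) → (d h : ℕ)
    → Poly.Monic F m → Poly.HasDegree F m d → 1 ≤ d
    → Poly.HasDegree F α h
    → Poly.Monic F (Poly.carlitz F m α) → Poly.Prime F (Poly.carlitz F m α)
    → (Poly.Monic F m × Poly.Prime F m) × Poly.NonzeroConstant F α
lemma2p1 q q≥3 F m α (suc d) h monic hm 1≤d hα _ (_ , irreducible) =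
  (monic , (suc d , hm , 1≤d) , irreducible-carlitz⇒irreducible m α hm hα irreducible)
  , irreducible-carlitz⇒constant m α hm hα irreducible
  where open IrreducibleCarlitzValues F q≥3
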